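{- For every graph $H$ there exists a constant $c'_H$, depending only on $H$, such that for all $n \geq |V(H)|$, \[ \operatorname{sat}(H, n) \geq \frac{\operatorname{wt}(H)-1}{2}\,n - c'_H. \]
   Context: All graphs are finite and simple. A graph $G$ is $H$-free if it has no subgraph isomorphic to $H$, and $H$-saturated if it is $H$-free and for every non-edge $xy$ of $G$ the graph $G+xy$ contains a subgraph isomorphic to $H$. For $n \geq |V(H)|$, $\operatorname{sat}(H,n)$ is the minimum number of edges of an $H$-saturated graph on $n$ vertices, with the convention $\operatorname{sat}(H,n)=\infty$ if no such graph exists (which happens only when $H$ has no edges). For an edge $uv$ of $H$, labelled so that $d(u) \leq d(v)$, its weight is $\operatorname{wt}(uv) = 2|N(u)\cap N(v)| + |N(v) - N(u)|$, where $N(\cdot)$ denotes the open neighborhood in $H$. The weight of $H$ is $\operatorname{wt}(H) = \min_{uv \in E(H)} \operatorname{wt}(uv)$, with $\operatorname{wt}(H)=\infty$ if $E(H)=\emptyset$. -}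

module Defs where

open import Data.Nat using (ℕ; zero; suc; _+_; _*_; _≤_; _<ᵇ_; _≤ᵇ_)
open import Data.Bool using (Bool; true; false; _∧_; _∨_; not; if_then_else_)
open import Data.Fin using (Fin; toℕ; _≟_)
open import Data.List using (List; map; concatMap)
open import Data.Nat.ListAction using (sum)
open import Data.List.Base using (allFin)
open import Data.Product using (Σ; ∃; _×_; _,_)
open import Relation.Nullary using (¬_)
open import Relation.Nullary.Decidable using (⌊_⌋)
open import Relation.Binary.PropositionalEquality using (_≡_; _≢_)
open import Function.Definitions using (Injective)

record Graph (n : ℕ) : Set where
  field
    adj   : Fin n → Fin n → Bool
    sym   : ∀ i j → adj i j ≡ adj j i
    irrefl : ∀ i → adj i i ≡ false
open Graph public

count : {n : ℕ} → (Fin n → Bool) → ℕ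
count {n} p = sum (map (λ w → if p w then 1 else 0) (allFin n))

numEdges : {n : ℕ} → Graph n → ℕ
numEdges {n} G =
  sum (concatMap (λ i → map (λ j → if (toℕ i <ᵇ toℕ j) ∧ adj G i j then 1 else 0)
                             (allFin n))
                 (allFin n))

Contains : {k n : ℕ} → Graph k → (Fin n → Fin n → Bool) → Set
Contains {k} {n} H A =
  Σ (Fin k → Fin n) λ f → Injective _≡_ _≡_ f ×
    (∀ a b → adj H a b ≡ true → A (f a) (f b) ≡ true)

addEdge : {n : ℕ} → (Fin n → Fin n → Bool) → Fin n → Fin n → (Fin n → Fin n → Bool)
addEdge A x y i j =
  A i j ∨ (⌊ i ≟ x ⌋ ∧ ⌊ j ≟ y ⌋) ∨ (⌊ i ≟ y ⌋ ∧ ⌊ j ≟ x ⌋)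

HFree : {k n : ℕ} → Graph k → Graph n → Set
HFree H G = ¬ Contains H (adj G)

Saturated : {k n : ℕ} → Graph k → Graph n → Set
Saturated H G =
  HFree H G ×
  (∀ x y → x ≢ y → adj G x y ≡ false → Contains H (addEdge (adj G) x y))

deg : {k : ℕ} → Graph k → Fin k → ℕ
deg H u = count (adj H u)

wt₀ : {k : ℕ} → Graph k → Fin k → Fin k → ℕ
wt₀ H u v = 2 * count (λ w → adj H u w ∧ adj H v w)
          + count (λ w → adj H v w ∧ not (adj H u w))

edgeWt : {k : ℕ} → Graph k → Fin k → Fin k → ℕ
edgeWt H u v = if deg H u ≤ᵇ deg H v then wt₀ H u v else wt₀ H v u

-- w = wt(H) = min over edges of edgeWt (only possible when E(H) ≠ ∅;
-- when E(H) = ∅, wt(H) = ∞ and no w satisfies this)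
IsWeight : {k : ℕ} → Graph k → ℕ → Set
IsWeight H w =
  (∃ λ u → ∃ λ v → adj H u v ≡ true × edgeWt H u v ≡ w) ×
  (∀ u v → adj H u v ≡ true → w ≤ edgeWt H u v)

module Submission where

-- Let W = wt(H) − 1. If xy is a non-edge of an H-saturated graph G with d(x) ≤ d(y), the
-- copy of H in G + xy maps some edge ab of H onto xy; the other neighbours of a and of b
-- land in N(x) and N(y), and common neighbours in N(x) ∩ N(y). As
-- wt(ab) = |N(a) ∩ N(b)| + max(d(a), d(b)), this gives W ≤ d(y) + |N(x) ∩ N(y)|.
-- Now let x have minimum degree δ. If δ ≥ W then 2e(G) ≥ nδ ≥ nW. Otherwise summing over
-- the n − δ − 1 non-neighbours y of x, and using Σ_y |N(x) ∩ N(y)| = Σ_{z ∈ N(x)} d(z),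
-- gives W(n − δ − 1) ≤ 2e(G), hence Wn ≤ 2e(G) + W², and W ≤ wt(H) ≤ 2|V(H)|.

open import Defs renaming (sym to adj-sym)
open import Data.Nat using (ℕ; zero; suc; _+_; _*_; _∸_; _≤_; _<_; _⊔_; _<ᵇ_; _≤ᵇ_; _≤?_; z≤n; s≤s)
open import Data.Nat.Properties hiding (_≟_; suc-injective)
open import Data.Nat.ListAction using (sum)
open import Data.Nat.ListAction.Properties using (sum-++)
open import Data.Bool using (Bool; true; false; _∧_; _∨_; not; if_then_else_)
open import Data.Bool.Properties as Bool using (∧-comm; ∨-comm; ∧-conicalˡ; ∧-conicalʳ)
open import Data.Fin using (Fin; zero; suc; toℕ; _≟_)
open import Data.Fin.Properties using (toℕ-injective; suc-injective; any?)
open import Data.List using (List; map; concat; tabulate; allFin)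
open import Data.List.Properties using (map-tabulate)
open import Data.List.Extrema.Nat using (argmin; f[argmin]≤f[xs])
open import Data.List.Membership.Propositional.Properties using (∈-allFin)
import Data.List.Relation.Unary.All as All
open import Data.Product using (∃; ∃₂; _×_; _,_; proj₁; proj₂)
open import Data.Sum using (_⊎_; inj₁; inj₂)
open import Data.Empty using (⊥-elim)
open import Function using (_∘_)
open import Function.Definitions using (Injective)
open import Relation.Binary.PropositionalEquality
open import Relation.Nullary using (yes; no; ¬_)
open import Relation.Nullary.Decidable using (⌊_⌋; _×-dec_)
open import Relation.Nullary.Reflects using (ofʸ; ofⁿ)
open import Algebra.Properties.CommutativeMonoid.Sum +-0-commutativeMonoid
  using (sum-syntax; sum-cong-≗; ∑-distrib-+; ∑-comm)

indicator : Bool → ℕ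
indicator b = if b then 1 else 0

∑-const : ∀ n c → ∑[ i < n ] c ≡ n * c
∑-const zero    c = refl
∑-const (suc n) c = cong (c +_) (∑-const n c)

∑-mono-≤ : ∀ {n} {f g : Fin n → ℕ} → (∀ i → f i ≤ g i) → ∑[ i < n ] f i ≤ ∑[ i < n ] g i
∑-mono-≤ {zero}  f≤g = z≤n
∑-mono-≤ {suc n} f≤g = +-mono-≤ (f≤g zero) (∑-mono-≤ (f≤g ∘ suc))

*-distribʳ-∑ : ∀ {n} c (f : Fin n → ℕ) → (∑[ i < n ] f i) * c ≡ ∑[ i < n ] (f i * c)
*-distribʳ-∑ {zero}  c f = refl
*-distribʳ-∑ {suc n} c f = trans (*-distribʳ-+ c (f zero) _) (cong (f zero * c +_) (*-distribʳ-∑ c (f ∘ suc)))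

∑-partition : ∀ {n} (p : Fin n → Bool) (f : Fin n → ℕ) →
  ∑[ i < n ] f i ≡ ∑[ i < n ] (if p i then f i else 0) + ∑[ i < n ] (if p i then 0 else f i)
∑-partition p f =
  trans (sum-cong-≗ split) (∑-distrib-+ (λ i → if p i then f i else 0) (λ i → if p i then 0 else f i))
  where
  split : ∀ i → f i ≡ (if p i then f i else 0) + (if p i then 0 else f i)
  split i with p i
  ... | true  = sym (+-identityʳ (f i))
  ... | false = refl

sum-tabulate : ∀ {n} (f : Fin n → ℕ) → sum (tabulate f) ≡ ∑[ i < n ] f i
sum-tabulate {zero}  f = refl
sum-tabulate {suc n} f = cong (f zero +_) (sum-tabulate (f ∘ suc))

sum-concat-tabulate : ∀ {n} (h : Fin n → List ℕ) → sum (concat (tabulate h)) ≡ ∑[ i < n ] sum (h i)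
sum-concat-tabulate {zero}  h = refl
sum-concat-tabulate {suc n} h =
  trans (sum-++ (h zero) _) (cong (sum (h zero) +_) (sum-concat-tabulate (h ∘ suc)))

sum-map-allFin : ∀ {n} (f : Fin n → ℕ) → sum (map f (allFin n)) ≡ ∑[ i < n ] f i
sum-map-allFin f = trans (cong sum (map-tabulate (λ i → i) f)) (sum-tabulate f)

count≡∑ : ∀ {n} (p : Fin n → Bool) → count p ≡ ∑[ i < n ] indicator (p i)
count≡∑ p = sum-map-allFin (indicator ∘ p)

count-suc : ∀ {n} (p : Fin (suc n) → Bool) → count p ≡ indicator (p zero) + count (p ∘ suc)
count-suc p = trans (count≡∑ p) (cong (indicator (p zero) +_) (sym (count≡∑ (p ∘ suc))))

count-cong : ∀ {n} {p q : Fin n → Bool} → (∀ i → p i ≡ q i) → count p ≡ count q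
count-cong {p = p} {q} p≗q =
  trans (count≡∑ p) (trans (sum-cong-≗ (cong indicator ∘ p≗q)) (sym (count≡∑ q)))

count-const : ∀ n b → count {n} (λ _ → b) ≡ n * indicator b
count-const n b = trans (count≡∑ {n} (λ _ → b)) (∑-const n (indicator b))

count-≤ : ∀ {n} (p : Fin n → Bool) → count p ≤ n
count-≤ {zero}  p = z≤n
count-≤ {suc n} p rewrite count-suc p = +-mono-≤ (indicator≤1 (p zero)) (count-≤ (p ∘ suc))
  where
  indicator≤1 : ∀ b → indicator b ≤ 1
  indicator≤1 true  = ≤-refl
  indicator≤1 false = z≤n

count-split : ∀ {n} (p q : Fin n → Bool) →
  count p ≡ count (λ i → p i ∧ q i) + count (λ i → p i ∧ not (q i))
count-split {n} p q = begin
  count p                                                          ≡⟨ count≡∑ p ⟩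
  ∑[ i < n ] indicator (p i)                                       ≡⟨ sum-cong-≗ split ⟩
  ∑[ i < n ] (indicator (p∧q i) + indicator (p∧¬q i))              ≡⟨ ∑-distrib-+ (indicator ∘ p∧q) (indicator ∘ p∧¬q) ⟩
  ∑[ i < n ] indicator (p∧q i) + ∑[ i < n ] indicator (p∧¬q i)     ≡⟨ cong₂ _+_ (count≡∑ p∧q) (count≡∑ p∧¬q) ⟨
  count p∧q + count p∧¬q                                           ∎
  where
  open ≡-Reasoning
  p∧q p∧¬q : Fin n → Bool
  p∧q i = p i ∧ q i
  p∧¬q i = p i ∧ not (q i)
  split : ∀ i → indicator (p i) ≡ indicator (p∧q i) + indicator (p∧¬q i)
  split i with p i | q i
  ... | true  | true  = refl
  ... | true  | false = refl
  ... | false | _     = refl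

count-singleton : ∀ {n} (t : Fin n) → count (λ i → ⌊ i ≟ t ⌋) ≡ 1
count-singleton {suc n} zero    = trans (count-suc {n} (λ i → ⌊ i ≟ zero ⌋)) (cong suc (trans (count-const n false) (*-zeroʳ n)))
count-singleton {suc n} (suc t) =
  trans (count-suc {n} (λ i → ⌊ i ≟ suc t ⌋)) (trans (count-cong suc≟suc) (count-singleton t))
  where
  suc≟suc : ∀ i → ⌊ suc i ≟ suc t ⌋ ≡ ⌊ i ≟ t ⌋
  suc≟suc i with i ≟ t
  ... | yes _ = refl
  ... | no  _ = refl

count-remove : ∀ {n} (p : Fin n → Bool) (t : Fin n) → p t ≡ true →
  count p ≡ suc (count (λ i → p i ∧ not ⌊ i ≟ t ⌋))
count-remove p t pt = begin
  count p                                   ≡⟨ count-split p (λ i → ⌊ i ≟ t ⌋) ⟩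
  count (λ i → p i ∧ ⌊ i ≟ t ⌋) + rest       ≡⟨ cong (_+ rest) (count-cong only-t) ⟩
  count (λ i → ⌊ i ≟ t ⌋) + rest             ≡⟨ cong (_+ rest) (count-singleton t) ⟩
  suc rest                                  ∎
  where
  open ≡-Reasoning
  rest = count (λ i → p i ∧ not ⌊ i ≟ t ⌋)
  only-t : ∀ i → (p i ∧ ⌊ i ≟ t ⌋) ≡ ⌊ i ≟ t ⌋
  only-t i with i ≟ t
  ... | yes refl = cong (_∧ true) pt
  ... | no  _    = ∧-comm (p i) false

count-injective-≤ : ∀ {k n} (f : Fin k → Fin n) → Injective _≡_ _≡_ f →
  (p : Fin k → Bool) (q : Fin n → Bool) → (∀ a → p a ≡ true → q (f a) ≡ true) →
  count p ≤ count q
count-injective-≤ {zero}  f f-inj p q pq = z≤n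
count-injective-≤ {suc k} f f-inj p q pq rewrite count-suc p with p zero in p0
... | false = count-injective-≤ (f ∘ suc) (suc-injective ∘ f-inj) (p ∘ suc) q (pq ∘ suc)
... | true  rewrite count-remove q (f zero) (pq zero p0) =
  s≤s (count-injective-≤ (f ∘ suc) (suc-injective ∘ f-inj) (p ∘ suc) _ pq′)
  where
  pq′ : ∀ a → p (suc a) ≡ true → (q (f (suc a)) ∧ not ⌊ f (suc a) ≟ f zero ⌋) ≡ true
  pq′ a pa with f (suc a) ≟ f zero
  ... | yes fa≡f0 with () ← f-inj fa≡f0
  ... | no  _     = trans (∧-comm _ true) (pq (suc a) pa)

codeg : ∀ {n} → Graph n → Fin n → Fin n → ℕ
codeg G x y = count (λ z → adj G x z ∧ adj G y z)

codeg-sym : ∀ {n} (G : Graph n) x y → codeg G x y ≡ codeg G y x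
codeg-sym G x y = count-cong (λ z → ∧-comm (adj G x z) (adj G y z))

handshake : ∀ {n} (G : Graph n) → 2 * numEdges G ≡ ∑[ i < n ] deg G i
handshake {n} G = begin
  2 * numEdges G                                     ≡⟨ cong (2 *_) numEdges≡∑∑ ⟩
  E + (E + 0)                                        ≡⟨ cong (E +_) (+-identityʳ E) ⟩
  E + E                                              ≡⟨ cong (E +_) (∑-comm e) ⟩
  E + ∑[ i < n ] ∑[ j < n ] e j i
    ≡⟨ ∑-distrib-+ (λ i → ∑[ j < n ] e i j) (λ i → ∑[ j < n ] e j i) ⟨
  ∑[ i < n ] (∑[ j < n ] e i j + ∑[ j < n ] e j i)   ≡⟨ sum-cong-≗ (λ i → ∑-distrib-+ (e i) (λ j → e j i)) ⟨
  ∑[ i < n ] ∑[ j < n ] (e i j + e j i)              ≡⟨ sum-cong-≗ (λ i → sum-cong-≗ (oriented-pair i)) ⟩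
  ∑[ i < n ] ∑[ j < n ] indicator (adj G i j)        ≡⟨ sum-cong-≗ (λ i → count≡∑ (adj G i)) ⟨
  ∑[ i < n ] deg G i                                 ∎
  where
  open ≡-Reasoning
  e : Fin n → Fin n → ℕ
  e i j = indicator ((toℕ i <ᵇ toℕ j) ∧ adj G i j)
  E = ∑[ i < n ] ∑[ j < n ] e i j
  numEdges≡∑∑ : numEdges G ≡ E
  numEdges≡∑∑ = begin
    numEdges G                                   ≡⟨ cong (sum ∘ concat) (map-tabulate (λ i → i) row) ⟩
    sum (concat (tabulate row))                  ≡⟨ sum-concat-tabulate row ⟩
    ∑[ i < n ] sum (row i)                       ≡⟨ sum-cong-≗ (λ i → sum-map-allFin (e i)) ⟩
    E                                            ∎
    where
    row : Fin n → List ℕ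
    row i = map (e i) (allFin n)
  oriented-pair : ∀ i j → e i j + e j i ≡ indicator (adj G i j)
  oriented-pair i j with toℕ i <ᵇ toℕ j | <ᵇ-reflects-< (toℕ i) (toℕ j)
                       | toℕ j <ᵇ toℕ i | <ᵇ-reflects-< (toℕ j) (toℕ i)
  ... | true  | ofʸ i<j | true  | ofʸ j<i = ⊥-elim (<-asym i<j j<i)
  ... | true  | _       | false | _       = +-identityʳ _
  ... | false | _       | true  | _       = cong indicator (adj-sym G j i)
  ... | false | ofⁿ i≮j | false | ofⁿ j≮i
    rewrite toℕ-injective (≤-antisym (≮⇒≥ j≮i) (≮⇒≥ i≮j)) = cong indicator (sym (irrefl G j))

∑-codeg : ∀ {n} (G : Graph n) x →
  ∑[ y < n ] codeg G x y ≡ ∑[ z < n ] (if adj G x z then deg G z else 0)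
∑-codeg {n} G x = begin
  ∑[ y < n ] codeg G x y                                    ≡⟨ sum-cong-≗ (λ y → count≡∑ (common y)) ⟩
  ∑[ y < n ] ∑[ z < n ] indicator (adj G x z ∧ adj G y z)   ≡⟨ ∑-comm (λ y z → indicator (common y z)) ⟩
  ∑[ z < n ] ∑[ y < n ] indicator (adj G x z ∧ adj G y z)
    ≡⟨ sum-cong-≗ (λ z → sum-cong-≗ (λ y → cong (λ b → indicator (adj G x z ∧ b)) (adj-sym G y z))) ⟩
  ∑[ z < n ] ∑[ y < n ] indicator (adj G x z ∧ adj G z y)   ≡⟨ sum-cong-≗ (λ z → restrict (adj G x z) (adj G z)) ⟩
  ∑[ z < n ] (if adj G x z then deg G z else 0)             ∎
  where
  open ≡-Reasoning
  common : Fin n → Fin n → Bool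
  common y z = adj G x z ∧ adj G y z
  restrict : ∀ b (p : Fin n → Bool) → ∑[ y < n ] indicator (b ∧ p y) ≡ (if b then count p else 0)
  restrict true  p = sym (count≡∑ p)
  restrict false p = trans (∑-const n 0) (*-zeroʳ n)

wt₀≡codeg+deg : ∀ {k} (H : Graph k) u v → wt₀ H u v ≡ codeg H u v + deg H v
wt₀≡codeg+deg H u v = begin
  wt₀ H u v                       ≡⟨ cong (λ m → C + m + D) (+-identityʳ C) ⟩
  C + C + D                       ≡⟨ +-assoc C C D ⟩
  C + (C + D)                     ≡⟨ cong (λ m → C + (m + D)) (codeg-sym H u v) ⟩
  C + (codeg H v u + D)           ≡⟨ cong (C +_) (count-split (adj H v) (adj H u)) ⟨
  C + deg H v                     ∎
  where
  open ≡-Reasoning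
  C = codeg H u v
  D = count (λ z → adj H v z ∧ not (adj H u z))

edgeWt≡codeg+⊔ : ∀ {k} (H : Graph k) u v → edgeWt H u v ≡ codeg H u v + (deg H u ⊔ deg H v)
edgeWt≡codeg+⊔ H u v with deg H u ≤ᵇ deg H v | ≤ᵇ-reflects-≤ (deg H u) (deg H v)
... | true  | ofʸ du≤dv =
  trans (wt₀≡codeg+deg H u v) (cong (codeg H u v +_) (sym (m≤n⇒m⊔n≡n du≤dv)))
... | false | ofⁿ du≰dv =
  trans (wt₀≡codeg+deg H v u) (cong₂ _+_ (codeg-sym H v u) (sym (m≥n⇒m⊔n≡m (<⇒≤ (≰⇒> du≰dv)))))

weight≤ : ∀ {k} (H : Graph k) {w} → IsWeight H w → w ≤ k + k
weight≤ {k} H {w} ((u , v , _ , wt≡w) , _) = begin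
  w                                 ≡⟨ wt≡w ⟨
  edgeWt H u v                      ≡⟨ edgeWt≡codeg+⊔ H u v ⟩
  codeg H u v + (deg H u ⊔ deg H v)
    ≤⟨ +-mono-≤ (count-≤ _) (⊔-lub (count-≤ (adj H u)) (count-≤ (adj H v))) ⟩
  k + k                             ∎
  where open ≤-Reasoning

addEdge-comm : ∀ {n} (A : Fin n → Fin n → Bool) x y i j → addEdge A x y i j ≡ addEdge A y x i j
addEdge-comm A x y i j = cong (A i j ∨_) (∨-comm (⌊ i ≟ x ⌋ ∧ ⌊ j ≟ y ⌋) (⌊ i ≟ y ⌋ ∧ ⌊ j ≟ x ⌋))

addEdge-true : ∀ {n} (A : Fin n → Fin n → Bool) x y i j → addEdge A x y i j ≡ true →
  A i j ≡ true ⊎ (i ≡ x × j ≡ y) ⊎ (i ≡ y × j ≡ x)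
addEdge-true A x y i j e with A i j | i ≟ x | j ≟ y | i ≟ y | j ≟ x
... | true  | _       | _       | _       | _       = inj₁ refl
... | false | yes i≡x | yes j≡y | _       | _       = inj₂ (inj₁ (i≡x , j≡y))
... | false | _       | _       | yes i≡y | yes j≡x = inj₂ (inj₂ (i≡y , j≡x))
... | false | no _    | _       | no _    | _       with () ← e
... | false | no _    | _       | yes _   | no _    with () ← e
... | false | yes _   | no _    | no _    | _       with () ← e
... | false | yes _   | no _    | yes _   | no _    with () ← e

Homomorphism : ∀ {k n} → Graph k → (Fin n → Fin n → Bool) → (Fin k → Fin n) → Set
Homomorphism H A f = ∀ a b → adj H a b ≡ true → A (f a) (f b) ≡ true

copy-uses-new-edge : ∀ {k n} (H : Graph k) (A : Fin n → Fin n → Bool) {x y} →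
  ¬ Contains H A → (f : Fin k → Fin n) → Injective _≡_ _≡_ f → Homomorphism H (addEdge A x y) f →
  ∃₂ λ a b → adj H a b ≡ true × f a ≡ x × f b ≡ y
copy-uses-new-edge H A {x} {y} H⊈A f f-inj hom
  with any? (λ a → any? (λ b → ((adj H a b Bool.≟ true) ×-dec (f a ≟ x)) ×-dec (f b ≟ y)))
... | yes (a , b , (ab , fa≡x) , fb≡y) = a , b , ab , fa≡x , fb≡y
... | no  unused = ⊥-elim (H⊈A (f , f-inj , hom′))
  where
  hom′ : Homomorphism H A f
  hom′ c d cd with addEdge-true A x y (f c) (f d) (hom c d cd)
  ... | inj₁ A-cd                  = A-cd
  ... | inj₂ (inj₁ (fc≡x , fd≡y)) = ⊥-elim (unused (c , d , (cd , fc≡x) , fd≡y))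
  ... | inj₂ (inj₂ (fc≡y , fd≡x)) = ⊥-elim (unused (d , c , (trans (adj-sym H d c) cd , fd≡x) , fc≡y))

adjacent-distinct : ∀ {k} (H : Graph k) {u v} → adj H u v ≡ true → u ≢ v
adjacent-distinct H {u} uv refl with () ← trans (sym (irrefl H u)) uv

not-≟-true : ∀ {n} {i j : Fin n} → not ⌊ i ≟ j ⌋ ≡ true → i ≢ j
not-≟-true {i = i} {j} e with i ≟ j
... | no i≢j = i≢j
... | yes _ with () ← e

record NewEdgeCopy {k n} (H : Graph k) (G : Graph n) (x y : Fin n) : Set where
  field
    embed        : Fin k → Fin n
    injective    : Injective _≡_ _≡_ embed
    homomorphism : Homomorphism H (addEdge (adj G) x y) embed
    source       : Fin k
    target       : Fin k
    edge         : adj H source target ≡ true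
    source↦x     : embed source ≡ x
    target↦y     : embed target ≡ y

saturated⇒newEdgeCopy : ∀ {k n} {H : Graph k} {G : Graph n} → Saturated H G →
  ∀ x y → x ≢ y → adj G x y ≡ false → NewEdgeCopy H G x y
saturated⇒newEdgeCopy {H = H} {G} (H-free , saturating) x y x≢y xy∉G
  with saturating x y x≢y xy∉G
... | f , f-inj , hom with copy-uses-new-edge H (adj G) H-free f f-inj hom
... | a , b , ab , fa≡x , fb≡y = record
  { embed = f ; injective = f-inj ; homomorphism = hom
  ; source = a ; target = b ; edge = ab ; source↦x = fa≡x ; target↦y = fb≡y }

module _ {k n} {H : Graph k} {G : Graph n} where

  reverse : ∀ {x y} → NewEdgeCopy H G x y → NewEdgeCopy H G y x
  reverse {x} {y} c = record
    { embed = embed ; injective = injective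
    ; homomorphism = λ a b ab → trans (sym (addEdge-comm (adj G) x y _ _)) (homomorphism a b ab)
    ; source = target ; target = source ; edge = trans (adj-sym H target source) edge
    ; source↦x = target↦y ; target↦y = source↦x }
    where open NewEdgeCopy c

  module _ {x y} (c : NewEdgeCopy H G x y) where
    open NewEdgeCopy c

    endpoints-distinct : x ≢ y
    endpoints-distinct x≡y =
      adjacent-distinct H edge (injective (trans source↦x (trans x≡y (sym target↦y))))

    target-neighbour : ∀ z → adj H target z ≡ true → z ≢ source → adj G y (embed z) ≡ true
    target-neighbour z tz z≢s
      with addEdge-true (adj G) x y (embed target) (embed z) (homomorphism target z tz)
    ... | inj₁ G-tz              = subst (λ t → adj G t (embed z) ≡ true) target↦y G-tz
    ... | inj₂ (inj₁ (t↦x , _)) = ⊥-elim (endpoints-distinct (trans (sym t↦x) target↦y))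
    ... | inj₂ (inj₂ (_ , z↦x)) = ⊥-elim (z≢s (injective (trans z↦x (sym source↦x))))

    target-degree : deg H target ≤ suc (deg G y)
    target-degree = begin
      deg H target
        ≡⟨ count-remove (adj H target) source (trans (adj-sym H target source) edge) ⟩
      suc (count (λ z → adj H target z ∧ not ⌊ z ≟ source ⌋))
        ≤⟨ s≤s (count-injective-≤ embed injective _ (adj G y) neighbour) ⟩
      suc (deg G y)                                         ∎
      where
      open ≤-Reasoning
      neighbour : ∀ z → (adj H target z ∧ not ⌊ z ≟ source ⌋) ≡ true → adj G y (embed z) ≡ true
      neighbour z e =
        target-neighbour z (∧-conicalˡ _ _ e) (not-≟-true (∧-conicalʳ (adj H target z) _ e))

  common-neighbours : ∀ {x y} (c : NewEdgeCopy H G x y) →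
    codeg H (NewEdgeCopy.source c) (NewEdgeCopy.target c) ≤ codeg G x y
  common-neighbours {x} {y} c = count-injective-≤ embed injective _ _ common
    where
    open NewEdgeCopy c
    common : ∀ z → (adj H source z ∧ adj H target z) ≡ true →
             (adj G x (embed z) ∧ adj G y (embed z)) ≡ true
    common z e = cong₂ _∧_ (target-neighbour (reverse c) z sz (adjacent-distinct H tz ∘ sym))
                           (target-neighbour c z tz (adjacent-distinct H sz ∘ sym))
      where
      sz = ∧-conicalˡ _ _ e
      tz = ∧-conicalʳ (adj H source z) _ e

  edgeWt-≤ : ∀ {x y} (c : NewEdgeCopy H G x y) →
    edgeWt H (NewEdgeCopy.source c) (NewEdgeCopy.target c) ≤ codeg G x y + suc (deg G x ⊔ deg G y)
  edgeWt-≤ {x} {y} c = begin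
    edgeWt H source target                      ≡⟨ edgeWt≡codeg+⊔ H source target ⟩
    codeg H source target + (deg H source ⊔ deg H target)
      ≤⟨ +-mono-≤ (common-neighbours c) (⊔-mono-≤ (target-degree (reverse c)) (target-degree c)) ⟩
    codeg G x y + suc (deg G x ⊔ deg G y)       ∎
    where
    open NewEdgeCopy c
    open ≤-Reasoning

DegreeCondition : ∀ {n} → Graph n → ℕ → Set
DegreeCondition G W = ∀ x y → x ≢ y → adj G x y ≡ false → deg G x ≤ deg G y → W ≤ deg G y + codeg G x y

saturated⇒degreeCondition : ∀ {k n} {H : Graph k} {G : Graph n} → Saturated H G →
  ∀ {w} → IsWeight H w → DegreeCondition G (w ∸ 1)
saturated⇒degreeCondition {H = H} {G} sat {w} (_ , w-min) x y x≢y xy∉G dx≤dy = ∸-monoˡ-≤ 1 (begin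
  w                                      ≤⟨ w-min source target edge ⟩
  edgeWt H source target                 ≤⟨ edgeWt-≤ c ⟩
  codeg G x y + suc (deg G x ⊔ deg G y)  ≡⟨ cong (λ d → codeg G x y + suc d) (m≤n⇒m⊔n≡n dx≤dy) ⟩
  codeg G x y + suc (deg G y)            ≡⟨ +-suc (codeg G x y) (deg G y) ⟩
  suc (codeg G x y + deg G y)            ≡⟨ cong suc (+-comm (codeg G x y) (deg G y)) ⟩
  suc (deg G y + codeg G x y)            ∎)
  where
  c : NewEdgeCopy H G x y
  c = saturated⇒newEdgeCopy sat x y x≢y xy∉G
  open NewEdgeCopy c
  open ≤-Reasoning

nonNeighbour : ∀ {n} → Graph n → Fin n → Fin n → Bool
nonNeighbour G x j = not (adj G x j) ∧ not ⌊ j ≟ x ⌋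

vertex-partition : ∀ {n} (G : Graph n) x → deg G x + suc (count (nonNeighbour G x)) ≡ n
vertex-partition {n} G x = begin
  deg G x + suc (count (nonNeighbour G x))   ≡⟨ cong (deg G x +_) (count-remove _ x (cong not (irrefl G x))) ⟨
  deg G x + count (λ j → not (adj G x j))    ≡⟨ count-split (λ _ → true) (adj G x) ⟨
  count {n} (λ _ → true)                     ≡⟨ count-const n true ⟩
  n * 1                                      ≡⟨ *-identityʳ n ⟩
  n                                          ∎
  where open ≡-Reasoning

nonNeighbours-bound : ∀ {n} (G : Graph n) {W} → DegreeCondition G W →
  ∀ x → (∀ j → deg G x ≤ deg G j) → count (nonNeighbour G x) * W ≤ ∑[ j < n ] deg G j
nonNeighbours-bound {n} G {W} condition x x-min = begin
  count (nonNeighbour G x) * W                              ≡⟨ cong (_* W) (count≡∑ (nonNeighbour G x)) ⟩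
  (∑[ j < n ] indicator (nonNeighbour G x j)) * W           ≡⟨ *-distribʳ-∑ W (indicator ∘ nonNeighbour G x) ⟩
  ∑[ j < n ] (indicator (nonNeighbour G x j) * W)           ≤⟨ ∑-mono-≤ pointwise ⟩
  ∑[ j < n ] (outside j + codeg G x j)                      ≡⟨ ∑-distrib-+ outside (codeg G x) ⟩
  ∑[ j < n ] outside j + ∑[ j < n ] codeg G x j             ≡⟨ cong (∑[ j < n ] outside j +_) (∑-codeg G x) ⟩
  ∑[ j < n ] outside j + ∑[ j < n ] inside j                ≡⟨ +-comm (∑[ j < n ] outside j) (∑[ j < n ] inside j) ⟩
  ∑[ j < n ] inside j + ∑[ j < n ] outside j                ≡⟨ ∑-partition (adj G x) (deg G) ⟨
  ∑[ j < n ] deg G j                                        ∎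
  where
  open ≤-Reasoning
  inside outside : Fin n → ℕ
  inside j  = if adj G x j then deg G j else 0
  outside j = if adj G x j then 0 else deg G j
  pointwise : ∀ j → indicator (nonNeighbour G x j) * W ≤ outside j + codeg G x j
  pointwise j with adj G x j in xj | j ≟ x
  ... | true  | _     = z≤n
  ... | false | yes _ = z≤n
  ... | false | no j≢x = ≤-trans (≤-reflexive (+-identityʳ W)) (condition x j (j≢x ∘ sym) xj (x-min j))

minimiser : ∀ {m} (f : Fin (suc m) → ℕ) → ∃ λ x → ∀ j → f x ≤ f j
minimiser {m} f =
  argmin f zero (allFin (suc m)) , λ j → All.lookup (f[argmin]≤f[xs] {f = f} zero (allFin (suc m))) (∈-allFin j)

minimum-degree-bound : ∀ {n} (G : Graph n) {W} x → (∀ j → deg G x ≤ deg G j) → W ≤ deg G x →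
  W * n ≤ ∑[ j < n ] deg G j
minimum-degree-bound {n} G {W} x x-min W≤δ = begin
  W * n                  ≡⟨ *-comm W n ⟩
  n * W                  ≤⟨ *-monoʳ-≤ n W≤δ ⟩
  n * deg G x            ≡⟨ ∑-const n (deg G x) ⟨
  ∑[ j < n ] deg G x     ≤⟨ ∑-mono-≤ x-min ⟩
  ∑[ j < n ] deg G j     ∎
  where open ≤-Reasoning

nonNeighbours-degree-bound : ∀ {n} (G : Graph n) {W} → DegreeCondition G W →
  ∀ x → (∀ j → deg G x ≤ deg G j) → deg G x < W → W * n ≤ ∑[ j < n ] deg G j + W * W
nonNeighbours-degree-bound {n} G {W} condition x x-min δ<W = begin
  W * n                            ≡⟨ cong (W *_) (vertex-partition G x) ⟨
  W * (deg G x + suc M)            ≡⟨ cong (W *_) (+-suc (deg G x) M) ⟩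
  W * (suc (deg G x) + M)          ≡⟨ *-distribˡ-+ W (suc (deg G x)) M ⟩
  W * suc (deg G x) + W * M        ≡⟨ +-comm (W * suc (deg G x)) (W * M) ⟩
  W * M + W * suc (deg G x)        ≡⟨ cong (_+ W * suc (deg G x)) (*-comm W M) ⟩
  M * W + W * suc (deg G x)        ≤⟨ +-mono-≤ (nonNeighbours-bound G condition x x-min) (*-monoʳ-≤ W δ<W) ⟩
  ∑[ j < n ] deg G j + W * W       ∎
  where
  M = count (nonNeighbour G x)
  open ≤-Reasoning

degree-sum-bound : ∀ {n} (G : Graph n) {W} → DegreeCondition G W →
  ∀ x → (∀ j → deg G x ≤ deg G j) → W * n ≤ ∑[ j < n ] deg G j + W * W
degree-sum-bound G {W} condition x x-min with W ≤? deg G x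
... | yes W≤δ = ≤-trans (minimum-degree-bound G x x-min W≤δ) (m≤m+n _ (W * W))
... | no  W≰δ = nonNeighbours-degree-bound G condition x x-min (≰⇒> W≰δ)

edges-lower-bound : ∀ {n} (G : Graph n) W → DegreeCondition G W → W * n ≤ 2 * numEdges G + W * W
edges-lower-bound {zero}  G W _ rewrite *-zeroʳ W = z≤n
edges-lower-bound {suc m} G W condition =
  subst (λ e → W * suc m ≤ e + W * W) (sym (handshake G))
        (degree-sum-bound G condition (proj₁ minimum) (proj₂ minimum))
  where
  minimum : ∃ λ x → ∀ j → deg G x ≤ deg G j
  minimum = minimiser (deg G)

-- The bound holds for every n.
lemma4 : ∀ {k : ℕ} (H : Graph k) → ∃ λ (c : ℕ) →
           ∀ (n : ℕ) → k ≤ n → (G : Graph n) → Saturated H G →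
           ∀ (w : ℕ) → IsWeight H w →
           (w ∸ 1) * n ≤ 2 * numEdges G + 2 * c
lemma4 {k} H = c , λ n _ G saturated w w-weight → begin
  (w ∸ 1) * n
    ≤⟨ edges-lower-bound G (w ∸ 1) (saturated⇒degreeCondition {H = H} {G = G} saturated w-weight) ⟩
  2 * numEdges G + (w ∸ 1) * (w ∸ 1)
    ≤⟨ +-monoʳ-≤ (2 * numEdges G) (square≤ (≤-trans (m∸n≤m w 1) (weight≤ H w-weight))) ⟩
  2 * numEdges G + 2 * c
    ∎
  where
  open ≤-Reasoning
  c = (k + k) * (k + k)
  square≤ : ∀ {W} → W ≤ k + k → W * W ≤ 2 * c
  square≤ W≤2k = ≤-trans (*-mono-≤ W≤2k W≤2k) (m≤m+n c (c + 0))
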